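{- Let $n,r,s,q$ be non-negative integers with $0\le s\le\min(q,r)$ and $q+(r-s)\le n$. Let $\pi$ be a fixed permutation of $[n]$, let $x_1,\dots,x_r\in[n]$ be distinct, and let $y_i=\pi(x_i)$ for $i=1,\dots,r$. Let $(x_1',y_1'),\dots,(x_q',y_q')$ be pairs in $[n]^2$ such that all $x_j'$ are distinct, all $y_j'$ are distinct, and for $i=1,\dots,s$ we have $x_i=x_i'$ or $y_i=y_i'$. Let $\pi'=\mathrm{Swap}(\pi;x_1,\dots,x_r)$. Then $$P\bigl(\pi'(x_1')=y_1'\wedge\dots\wedge\pi'(x_q')=y_q'\bigr)\le\frac{(n-r)!\,(n-q)!}{n!\,(n-q-r+s)!}.$$
   Context: $\mathrm{Swap}(\pi;x_1,\dots,x_r)$, for a permutation $\pi$ of $[n]$ and distinct $x_1,\dots,x_r\in[n]$, is the random permutation obtained as follows: for $i=1,\dots,r$ in turn, choose $x_i'$ uniformly at random from $[n]\setminus\{x_1,\dots,x_{i-1}\}$ (independently) and exchange the values of the current permutation at positions $x_i$ and $x_i'$. -}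

module Defs where

open import Data.Nat using (ℕ; zero; suc)
open import Data.Bool using (Bool; true; false; not; _∧_; if_then_else_)
open import Data.Fin using (Fin; _≟_)
open import Data.Vec using (Vec; []; _∷_)
open import Data.List using (List; []; _∷_; [_]; map; concatMap; filterᵇ; length; allFin)
open import Relation.Nullary using (does)

_==_ : ∀ {n} → Fin n → Fin n → Bool
a == b = does (a ≟ b)

elemᵇ : ∀ {n} → Fin n → List (Fin n) → Bool
elemᵇ a []       = false
elemᵇ a (b ∷ bs) = (a == b) Data.Bool.∨ elemᵇ a bs

swapAt : ∀ {n} → (Fin n → Fin n) → Fin n → Fin n → (Fin n → Fin n)
swapAt f a b x = if x == a then f b else (if x == b then f a else f x)

runSwap : ∀ {n r} → (Fin n → Fin n) → Vec (Fin n) r → Vec (Fin n) r → (Fin n → Fin n)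
runSwap f []       []       = f
runSwap f (x ∷ xs) (c ∷ cs) = runSwap (swapAt f x c) xs cs

admissibleFrom : ∀ {n r} → List (Fin n) → Vec (Fin n) r → Vec (Fin n) r → Bool
admissibleFrom used []       []       = true
admissibleFrom used (x ∷ xs) (c ∷ cs) = not (elemᵇ c used) ∧ admissibleFrom (x ∷ used) xs cs

admissible : ∀ {n r} → Vec (Fin n) r → Vec (Fin n) r → Bool
admissible = admissibleFrom []

allVecs : ∀ n r → List (Vec (Fin n) r)
allVecs n zero    = [ [] ]
allVecs n (suc r) = concatMap (λ a → map (a ∷_) (allVecs n r)) (allFin n)

-- The independent uniform choices make every admissible sequence equally likely,
-- so probabilities are (number of favourable sequences) / (size of sample space).
sampleSpace : ∀ {n r} → Vec (Fin n) r → List (Vec (Fin n) r)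
sampleSpace {n} {r} xs = filterᵇ (admissible xs) (allVecs n r)

allMatch : ∀ {n q} → (Fin n → Fin n) → Vec (Fin n) q → Vec (Fin n) q → Bool
allMatch σ []       []       = true
allMatch σ (a ∷ as) (b ∷ bs) = (σ a == b) ∧ allMatch σ as bs

favourable : ∀ {n r q} → (Fin n → Fin n) → Vec (Fin n) r → Vec (Fin n) q → Vec (Fin n) q → ℕ
favourable π xs xq yq = length (filterᵇ (λ cs → allMatch (runSwap π xs cs) xq yq) (sampleSpace xs))

-- Count the admissible choice sequences position by position. At an intermediate stage let M be
-- the number of unused choices, q the number of target pairs still to be met (each value y′ⱼ
-- having an unused preimage), and s the number of remaining positions attached to a pending pair
-- (x = x′ⱼ or π x = y′ⱼ); then at most (M − q) P (r − s) of the completions over the r remaining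
-- positions meet all pending pairs. At the next position x: if x = x′ₖ for a pending k, the choice
-- is forced and k is discharged; if x is attached to a pending l, relabelling the values by a
-- transposition shows that all choices together cost no more than discharging l; otherwise the
-- choice must avoid the q unused preimages, leaving at most M − q options. There are at least
-- n P r choice sequences, and (n − q) P (r − s) · n! (n − q − r + s)! = n P r · (n − r)! (n − q)!.

module Submission where

open import Defs
open import Data.Nat using (ℕ; _+_; _*_; _∸_; _≤_; _<_; _!)
open import Data.Fin using (Fin; toℕ)
open import Data.Fin.Permutation using (Permutation′; _⟨$⟩ʳ_)
open import Data.Vec using (Vec; lookup)
open import Data.List using (length)
open import Data.Sum using (_⊎_)
open import Relation.Binary.PropositionalEquality using (_≡_)

open import Data.Bool using (Bool; true; false; not; _∧_; _∨_; if_then_else_; T)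
open import Data.Bool.Properties using (T-∧)
open import Data.Empty using (⊥-elim)
open import Data.Fin using (zero; suc; _≟_; punchIn; fromℕ<)
open import Data.Fin.Properties using (punchInᵢ≢i; suc-injective; any?; all?; toℕ-injective; toℕ-fromℕ<)
open import Data.Fin.Permutation using (_⟨$⟩ˡ_; inverseʳ)
open import Data.Fin.Permutation.Components using (transpose; transpose-inverse)
open import Data.List using (List; []; _∷_; _++_; map; concatMap; filterᵇ; tabulate; allFin)
open import Data.List.Membership.Propositional using (_∈_; _∉_)
open import Data.List.Relation.Unary.Any using (here; there)
import Data.List.Relation.Unary.Any as Any
open import Data.Nat using (zero; suc; z≤n; s≤s; _<?_)
open import Data.Nat.Combinatorics.Base using (_P′_)
open import Data.Nat.Properties using
  ( *-assoc; *-commutativeSemigroup; *-identityˡ; *-monoˡ-≤; +-*-semiring; +-assoc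
  ; +-comm; +-identityʳ; +-mono-≤; +-monoʳ-≤; +-monoˡ-≤; +-suc; +-∸-assoc; <-≤-trans
  ; m+[n∸m]≡n; m+n∸m≡n; m+n≤o⇒m≤o; m+n≤o⇒m≤o∸n; m<n⇒0<n∸m; m≤n+m; m≤n⇒m<n∨m≡n; n≤0⇒n≡0
  ; n≤1+n; ∸-+-assoc; ∸-monoʳ-≤; ∸-monoˡ-≤; ≤-antisym; ≤-pred; ≤-refl; ≤-reflexive
  ; ≤-trans; module ≤-Reasoning
  )
open import Data.Product using (∃; _,_; proj₁; proj₂; _×_)
open import Data.Sum using (inj₁; inj₂)
open import Data.Vec using ([]; _∷_; toList)
open import Data.Vec.Properties using (length-toList)
open import Function using (_∘_; id)
open import Function.Bundles using (Equivalence; Injection)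
open import Function.Properties.Inverse using (↔⇒↣)
open import Function.Definitions using (Injective)
open import Relation.Nullary using (Dec; yes; no; ¬_; does)
open import Relation.Nullary.Decidable using (dec-true; dec-false; map′; T?; _×-dec_; _→-dec_)
open import Relation.Binary.PropositionalEquality using (_≢_; refl; sym; trans; cong; cong₂; subst; subst₂; _≗_; module ≡-Reasoning)
open import Algebra.Properties.CommutativeSemigroup *-commutativeSemigroup using () renaming (x∙yz≈y∙xz to *-left-comm)
open import Algebra.Properties.Semiring.Sum +-*-semiring
  using (sum; sum-syntax; sum-cong-≗; sum-replicate-zero; sum-remove; ∑-comm; ∑-distrib-+; *-distribʳ-sum)

-- Indicators and finite sums

𝟙 : Bool → ℕ
𝟙 b = if b then 1 else 0

𝟙≤1 : ∀ b → 𝟙 b ≤ 1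
𝟙≤1 true  = ≤-refl
𝟙≤1 false = z≤n

𝟙-mono : ∀ {b b′} → (T b → T b′) → 𝟙 b ≤ 𝟙 b′
𝟙-mono {false}        _    = z≤n
𝟙-mono {true} {true}  _    = ≤-refl
𝟙-mono {true} {false} b⇒b′ = ⊥-elim (b⇒b′ _)

𝟙-≡0 : ∀ {b} → ¬ T b → 𝟙 b ≡ 0
𝟙-≡0 {false} _  = refl
𝟙-≡0 {true}  ¬b = ⊥-elim (¬b _)

does-T : ∀ {P : Set} (p? : Dec P) → T (does p?) → P
does-T (yes p) _ = p

T-does : ∀ {P : Set} (p? : Dec P) → P → T (does p?)
T-does (yes _) _ = _
T-does (no ¬p) p = ¬p p

𝟙-T : ∀ {b} → T b → 𝟙 b ≡ 1
𝟙-T {true} _ = refl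

𝟙-does-mono : ∀ {P Q : Set} (p? : Dec P) (q? : Dec Q) → (P → Q) → 𝟙 (does p?) ≤ 𝟙 (does q?)
𝟙-does-mono (no _)  _      _   = z≤n
𝟙-does-mono (yes _) (yes _) _   = ≤-refl
𝟙-does-mono (yes p) (no ¬q) P⇒Q = ⊥-elim (¬q (P⇒Q p))

sum-mono-≤ : ∀ {k} {f g : Fin k → ℕ} → (∀ i → f i ≤ g i) → sum f ≤ sum g
sum-mono-≤ {zero}  _   = z≤n
sum-mono-≤ {suc k} f≤g = +-mono-≤ (f≤g zero) (sum-mono-≤ (f≤g ∘ suc))

sum-≗0 : ∀ {k} {f : Fin k → ℕ} → (∀ i → f i ≡ 0) → sum f ≡ 0
sum-≗0 {k} f≗0 = trans (sum-cong-≗ f≗0) (sum-replicate-zero k)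

sum-const-1 : ∀ k → ∑[ i < k ] 1 ≡ k
sum-const-1 zero    = refl
sum-const-1 (suc k) = cong suc (sum-const-1 k)

sum-single : ∀ {k} (f : Fin k → ℕ) p → (∀ i → i ≢ p → f i ≡ 0) → sum f ≡ f p
sum-single {suc k} f p others = begin
  sum f                     ≡⟨ sum-remove {i = p} f ⟩
  f p + sum (f ∘ punchIn p) ≡⟨ cong (f p +_) (sum-≗0 λ i → others (punchIn p i) (punchInᵢ≢i p i)) ⟩
  f p + 0                   ≡⟨ +-identityʳ (f p) ⟩
  f p                       ∎
  where open ≡-Reasoning

sum-𝟙≤𝟙-any : ∀ {k} (b : Fin k → Bool) → (∀ {i j} → T (b i) → T (b j) → i ≡ j) →
  sum (𝟙 ∘ b) ≤ 𝟙 (does (any? (T? ∘ b)))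
sum-𝟙≤𝟙-any b unique with any? (T? ∘ b)
... | yes (i , bᵢ) = ≤-trans (≤-reflexive (sum-single (𝟙 ∘ b) i λ j j≢i → 𝟙-≡0 (λ bⱼ → j≢i (unique bⱼ bᵢ)))) (𝟙≤1 (b i))
... | no none      = ≤-reflexive (sum-≗0 λ j → 𝟙-≡0 (λ bⱼ → none (j , bⱼ)))


sum-≥-prefix : ∀ {r s} (f : Fin r → ℕ) → s ≤ r → (∀ i → toℕ i < s → 1 ≤ f i) → s ≤ sum f
sum-≥-prefix {s = zero}  f _         _       = z≤n
sum-≥-prefix {s = suc s} f (s≤s s≤r) prefix  = +-mono-≤ (prefix zero (s≤s z≤n)) (sum-≥-prefix (f ∘ suc) s≤r λ i i<s → prefix (suc i) (s≤s i<s))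

private variable A B : Set

sumᴸ : (A → ℕ) → List A → ℕ
sumᴸ h []       = 0
sumᴸ h (a ∷ as) = h a + sumᴸ h as

sumᴸ-++ : ∀ (h : A → ℕ) as bs → sumᴸ h (as ++ bs) ≡ sumᴸ h as + sumᴸ h bs
sumᴸ-++ h []       bs = refl
sumᴸ-++ h (a ∷ as) bs = trans (cong (h a +_) (sumᴸ-++ h as bs)) (sym (+-assoc (h a) _ _))

sumᴸ-map : ∀ (h : B → ℕ) (f : A → B) as → sumᴸ h (map f as) ≡ sumᴸ (h ∘ f) as
sumᴸ-map h f []       = refl
sumᴸ-map h f (a ∷ as) = cong (h (f a) +_) (sumᴸ-map h f as)

sumᴸ-concatMap : ∀ (h : B → ℕ) (f : A → List B) as →
  sumᴸ h (concatMap f as) ≡ sumᴸ (sumᴸ h ∘ f) as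
sumᴸ-concatMap h f []       = refl
sumᴸ-concatMap h f (a ∷ as) = trans (sumᴸ-++ h (f a) _) (cong (sumᴸ h (f a) +_) (sumᴸ-concatMap h f as))

sumᴸ-tabulate : ∀ {k} (h : A → ℕ) (f : Fin k → A) → sumᴸ h (tabulate f) ≡ ∑[ i < k ] h (f i)
sumᴸ-tabulate {k = zero}  h f = refl
sumᴸ-tabulate {k = suc k} h f = cong (h (f zero) +_) (sumᴸ-tabulate h (f ∘ suc))

sumᴸ-mono-≤ : ∀ {h h′ : A → ℕ} as → (∀ {a} → a ∈ as → h a ≤ h′ a) → sumᴸ h as ≤ sumᴸ h′ as
sumᴸ-mono-≤ []       _    = z≤n
sumᴸ-mono-≤ (a ∷ as) h≤h′ = +-mono-≤ (h≤h′ (here refl)) (sumᴸ-mono-≤ as (h≤h′ ∘ there))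

sumᴸ-𝟙≤length : ∀ (p : A → Bool) as → sumᴸ (𝟙 ∘ p) as ≤ length as
sumᴸ-𝟙≤length p []       = z≤n
sumᴸ-𝟙≤length p (a ∷ as) = +-mono-≤ (𝟙≤1 (p a)) (sumᴸ-𝟙≤length p as)

length≡sumᴸ-1 : ∀ (as : List A) → length as ≡ sumᴸ (λ _ → 1) as
length≡sumᴸ-1 []       = refl
length≡sumᴸ-1 (a ∷ as) = cong suc (length≡sumᴸ-1 as)

sumᴸ-filterᵇ : ∀ (h : A → ℕ) (p : A → Bool) as →
  sumᴸ h (filterᵇ p as) ≡ sumᴸ (λ a → if p a then h a else 0) as
sumᴸ-filterᵇ h p []       = refl
sumᴸ-filterᵇ h p (a ∷ as) with p a
... | true  = cong (h a +_) (sumᴸ-filterᵇ h p as)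
... | false = sumᴸ-filterᵇ h p as

sumᴸ-0 : ∀ (as : List A) → sumᴸ (λ _ → 0) as ≡ 0
sumᴸ-0 []       = refl
sumᴸ-0 (a ∷ as) = sumᴸ-0 as

sumᴸ-toList : ∀ {r} (h : A → ℕ) (v : Vec A r) → sumᴸ h (toList v) ≡ ∑[ i < r ] h (lookup v i)
sumᴸ-toList h []      = refl
sumᴸ-toList h (a ∷ v) = cong (h a +_) (sumᴸ-toList h v)

-- Falling factorials

P′-suc : ∀ m k → suc m P′ suc k ≡ suc m * (m P′ k)
P′-suc m zero    = refl
P′-suc m (suc k) = begin
  (m ∸ k) * (suc m P′ suc k)    ≡⟨ cong ((m ∸ k) *_) (P′-suc m k) ⟩
  (m ∸ k) * (suc m * (m P′ k))  ≡⟨ *-left-comm (m ∸ k) (suc m) (m P′ k) ⟩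
  suc m * ((m ∸ k) * (m P′ k))  ∎
  where open ≡-Reasoning

P′-mono-suc : ∀ {m k} → k < m → m P′ k ≤ m P′ suc k
P′-mono-suc {m} {k} k<m = begin
  m P′ k             ≡⟨ *-identityˡ (m P′ k) ⟨
  1 * (m P′ k)       ≤⟨ *-monoˡ-≤ (m P′ k) (m<n⇒0<n∸m k<m) ⟩
  (m ∸ k) * (m P′ k) ∎
  where open ≤-Reasoning

P′-mono : ∀ {m j k} → j ≤ k → k ≤ m → m P′ j ≤ m P′ k
P′-mono {k = zero}  z≤n   _     = ≤-refl
P′-mono {k = suc k} j≤1+k 1+k≤m with m≤n⇒m<n∨m≡n j≤1+k
... | inj₂ refl      = ≤-refl
... | inj₁ (s≤s j≤k) = ≤-trans (P′-mono j≤k (≤-trans (n≤1+n k) 1+k≤m)) (P′-mono-suc 1+k≤m)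

P′*!≡! : ∀ {m k} → k ≤ m → (m P′ k) * (m ∸ k) ! ≡ m !
P′*!≡! {m}     {zero}  _         = *-identityˡ (m !)
P′*!≡! {suc m} {suc k} (s≤s k≤m) = begin
  (suc m P′ suc k) * (m ∸ k) !    ≡⟨ cong (_* (m ∸ k) !) (P′-suc m k) ⟩
  suc m * (m P′ k) * (m ∸ k) !    ≡⟨ *-assoc (suc m) (m P′ k) ((m ∸ k) !) ⟩
  suc m * ((m P′ k) * (m ∸ k) !)  ≡⟨ cong (suc m *_) (P′*!≡! k≤m) ⟩
  suc m * m !                     ∎
  where open ≡-Reasoning

P′-cross : ∀ {n q k r} → k ≤ n ∸ q → r ≤ n →
  ((n ∸ q) P′ k) * (n ! * (n ∸ (q + k)) !) ≡ (n P′ r) * ((n ∸ r) ! * (n ∸ q) !)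
P′-cross {n} {q} {k} {r} k≤n∸q r≤n = begin
  a * (n ! * (n ∸ (q + k)) !)        ≡⟨ cong (λ m → a * (n ! * m !)) (∸-+-assoc n q k) ⟨
  a * (n ! * (n ∸ q ∸ k) !)          ≡⟨ *-left-comm a (n !) ((n ∸ q ∸ k) !) ⟩
  n ! * (a * (n ∸ q ∸ k) !)          ≡⟨ cong (n ! *_) (P′*!≡! k≤n∸q) ⟩
  n ! * (n ∸ q) !                    ≡⟨ cong (_* (n ∸ q) !) (P′*!≡! r≤n) ⟨
  (n P′ r) * (n ∸ r) ! * (n ∸ q) !   ≡⟨ *-assoc (n P′ r) ((n ∸ r) !) ((n ∸ q) !) ⟩
  (n P′ r) * ((n ∸ r) ! * (n ∸ q) !) ∎
  where
  open ≡-Reasoning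
  a = (n ∸ q) P′ k

shrink-fits : ∀ {M q r S s} → suc q + (suc r ∸ S) ≤ suc M → S ≤ suc s → q + (r ∸ s) ≤ M
shrink-fits {q = q} {r} (s≤s fits) S≤1+s = ≤-trans (+-monoʳ-≤ q (∸-monoʳ-≤ (suc r) S≤1+s)) fits

shrink-bound : ∀ {M q r S s} → suc q + (suc r ∸ S) ≤ suc M → S ≤ suc s →
  (M ∸ q) P′ (r ∸ s) ≤ (M ∸ q) P′ (suc r ∸ S)
shrink-bound {q = q} {r} {S} (s≤s fits) S≤1+s =
  P′-mono (∸-monoʳ-≤ (suc r) S≤1+s) (≤-trans (≤-reflexive (sym (m+n∸m≡n q (suc r ∸ S)))) (∸-monoˡ-≤ q fits))

-- Positions and exchanges

_∈?_ : ∀ {n} (x : Fin n) (U : List (Fin n)) → Dec (x ∈ U)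
x ∈? U = Any.any? (x ≟_) U

elemᵇ≡does-∈? : ∀ {n} (x : Fin n) U → elemᵇ x U ≡ does (x ∈? U)
elemᵇ≡does-∈? x []      = refl
elemᵇ≡does-∈? x (u ∷ U) = cong (does (x ≟ u) ∨_) (elemᵇ≡does-∈? x U)

data Fresh {n} (U : List (Fin n)) : List (Fin n) → Set where
  []  : Fresh U []
  _∷_ : ∀ {x xs} → x ∉ U → Fresh (x ∷ U) xs → Fresh U (x ∷ xs)

module _ {n : ℕ} where

  ∈⇒∉-Fresh : ∀ {U xs : List (Fin n)} {y} → Fresh U xs → y ∈ U → y ∉ xs
  ∈⇒∉-Fresh (x∉U ∷ _)  y∈U (here refl)  = x∉U y∈U
  ∈⇒∉-Fresh (_   ∷ fr) y∈U (there y∈xs) = ∈⇒∉-Fresh fr (there y∈U) y∈xs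

  Fresh-head : ∀ {U xs : List (Fin n)} {x} → Fresh U (x ∷ xs) → x ∉ U
  Fresh-head (x∉U ∷ _) = x∉U

  Fresh-tail : ∀ {U xs : List (Fin n)} {x} → Fresh U (x ∷ xs) → Fresh (x ∷ U) xs
  Fresh-tail (_ ∷ fr) = fr

  head∉tail-Fresh : ∀ {U xs : List (Fin n)} {x} → Fresh U (x ∷ xs) → x ∉ xs
  head∉tail-Fresh (_ ∷ fr) = ∈⇒∉-Fresh fr (here refl)

  Fresh-toList : ∀ {r} {U : List (Fin n)} (v : Vec (Fin n) r) →
    (∀ i j → lookup v i ≡ lookup v j → i ≡ j) → (∀ i → lookup v i ∉ U) → Fresh U (toList v)
  Fresh-toList []      _   _   = []
  Fresh-toList (x ∷ v) inj out = out zero ∷ Fresh-toList v inj′ out′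
    where
    inj′ : ∀ i j → lookup v i ≡ lookup v j → i ≡ j
    inj′ i j vᵢ≡vⱼ = suc-injective (inj (suc i) (suc j) vᵢ≡vⱼ)
    out′ : ∀ i → lookup v i ∉ (x ∷ _)
    out′ i (here vᵢ≡x) with () ← inj (suc i) zero vᵢ≡x
    out′ i (there vᵢ∈U) = out (suc i) vᵢ∈U

  swapAt-at₁ : ∀ (f : Fin n → Fin n) a b → swapAt f a b a ≡ f b
  swapAt-at₁ f a b rewrite dec-true (a ≟ a) refl = refl

  swapAt-at₂ : ∀ (f : Fin n → Fin n) a b → swapAt f a b b ≡ f a
  swapAt-at₂ f a b with b ≟ a
  ... | yes refl = refl
  ... | no  _    rewrite dec-true (b ≟ b) refl = refl

  swapAt-other : ∀ (f : Fin n → Fin n) {a b y} → y ≢ a → y ≢ b → swapAt f a b y ≡ f y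
  swapAt-other f {a} {b} {y} y≢a y≢b rewrite dec-false (y ≟ a) y≢a | dec-false (y ≟ b) y≢b = refl

  swapAt-injective : ∀ {f : Fin n → Fin n} a b → Injective _≡_ _≡_ f → Injective _≡_ _≡_ (swapAt f a b)
  swapAt-injective {f} a b inj {y} {z} eq with y ≟ a | y ≟ b | z ≟ a | z ≟ b
  ... | yes refl | _        | yes refl | _        = refl
  ... | yes refl | _        | no  _    | yes refl = inj (sym eq)
  ... | yes refl | _        | no  z≢a  | no  z≢b  = ⊥-elim (z≢b (inj (sym eq)))
  ... | no  _    | yes refl | yes refl | _        = inj (sym eq)
  ... | no  _    | yes refl | no  _    | yes refl = refl
  ... | no  _    | yes refl | no  z≢a  | no  _    = ⊥-elim (z≢a (inj (sym eq)))
  ... | no  _    | no  y≢b  | yes refl | _        = ⊥-elim (y≢b (inj eq))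
  ... | no  y≢a  | no  _    | no  _    | yes refl = ⊥-elim (y≢a (inj eq))
  ... | no  _    | no  _    | no  _    | no  _    = inj eq

  preimage-swapAt : ∀ {f : Fin n → Fin n} {U x c p b} → f p ≡ b → p ∉ U → c ∉ U → p ≢ c →
    ∃ λ p′ → p′ ∉ x ∷ U × swapAt f x c p′ ≡ b
  preimage-swapAt {f} {U} {x} {c} {p} fp≡b p∉U c∉U p≢c with p ≟ x
  ... | yes refl = c , (λ { (here refl) → p≢c refl ; (there c∈U) → c∉U c∈U }) , trans (swapAt-at₂ f p c) fp≡b
  ... | no  p≢x  = p , (λ { (here refl) → p≢x refl ; (there p∈U) → p∉U p∈U }) , trans (swapAt-other f p≢x p≢c) fp≡b

  transpose-at₁ : ∀ (i j : Fin n) → transpose i j i ≡ j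
  transpose-at₁ i j rewrite dec-true (i ≟ i) refl = refl

  transpose-at₂ : ∀ (i j : Fin n) → transpose i j j ≡ i
  transpose-at₂ i j with j ≟ i
  ... | yes refl = refl
  ... | no  _    rewrite dec-true (j ≟ j) refl = refl

  transpose-other : ∀ {i j k : Fin n} → k ≢ i → k ≢ j → transpose i j k ≡ k
  transpose-other {i} {j} {k} k≢i k≢j rewrite dec-false (k ≟ i) k≢i | dec-false (k ≟ j) k≢j = refl

  transpose-solve : ∀ {i j k l : Fin n} → transpose i j k ≡ l → k ≡ transpose j i l
  transpose-solve {i} {j} {k} refl = sym (transpose-inverse j i)

  swapAt≡transpose : ∀ {f : Fin n → Fin n} → Injective _≡_ _≡_ f →
    ∀ a b y → swapAt f a b y ≡ transpose (f a) (f b) (f y)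
  swapAt≡transpose {f} inj a b y with y ≟ a | y ≟ b
  ... | yes refl | _        = sym (transpose-at₁ (f y) (f b))
  ... | no  y≢a  | yes refl = sym (transpose-at₂ (f a) (f y))
  ... | no  y≢a  | no  y≢b  = sym (transpose-other (y≢a ∘ inj) (y≢b ∘ inj))

-- Sums over the runs of the exchange process

Weight : ℕ → Set
Weight n = (Fin n → Fin n) → ℕ

module _ {n : ℕ} where

  whenUnused : List (Fin n) → Fin n → ℕ → ℕ
  whenUnused U c k = if does (c ∈? U) then 0 else k

  whenUnused-mono : ∀ {U c k k′} → (c ∉ U → k ≤ k′) → whenUnused U c k ≤ whenUnused U c k′
  whenUnused-mono {U} {c} k≤k′ with c ∈? U
  ... | yes _   = z≤n
  ... | no  c∉U = k≤k′ c∉U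

  whenUnused-cong : ∀ {U c k k′} → (c ∉ U → k ≡ k′) → whenUnused U c k ≡ whenUnused U c k′
  whenUnused-cong {U} {c} k≡k′ with c ∈? U
  ... | yes _   = refl
  ... | no  c∉U = k≡k′ c∉U

  whenUnused-≤ : ∀ {U c k} → whenUnused U c k ≤ k
  whenUnused-≤ {U} {c} with c ∈? U
  ... | yes _ = z≤n
  ... | no  _ = ≤-refl

  whenUnused-∉ : ∀ {U c k} → c ∉ U → whenUnused U c k ≡ k
  whenUnused-∉ {U} {c} c∉U rewrite dec-false (c ∈? U) c∉U = refl

  whenUnused-0 : ∀ {U c} → whenUnused U c 0 ≡ 0
  whenUnused-0 {U} {c} with c ∈? U
  ... | yes _ = refl
  ... | no  _ = refl

  whenUnused-*ʳ : ∀ {U c} k m → whenUnused U c k * m ≡ whenUnused U c (k * m)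
  whenUnused-*ʳ {U} {c} k m with c ∈? U
  ... | yes _ = refl
  ... | no  _ = refl

  sum-whenUnused : ∀ {U c k} (f : Fin k → ℕ) → ∑[ i < k ] whenUnused U c (f i) ≡ whenUnused U c (sum f)
  sum-whenUnused {U} {c} {k} f with c ∈? U
  ... | yes _ = sum-replicate-zero k
  ... | no  _ = refl

  unusedCount : List (Fin n) → ℕ
  unusedCount U = ∑[ c < n ] whenUnused U c 1

  unusedCount-[] : unusedCount [] ≡ n
  unusedCount-[] = sum-const-1 n

  sum-𝟙-≟ : ∀ (x : Fin n) → ∑[ c < n ] 𝟙 (does (c ≟ x)) ≡ 1
  sum-𝟙-≟ x = trans (sum-single _ x λ c c≢x → cong 𝟙 (dec-false (c ≟ x) c≢x)) (cong 𝟙 (dec-true (x ≟ x) refl))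

  unusedCount-∷ : ∀ {x U} → x ∉ U → unusedCount U ≡ suc (unusedCount (x ∷ U))
  unusedCount-∷ {x} {U} x∉U = begin
    ∑[ c < n ] whenUnused U c 1                                        ≡⟨ sum-cong-≗ split ⟩
    ∑[ c < n ] (𝟙 (does (c ≟ x)) + whenUnused (x ∷ U) c 1)             ≡⟨ ∑-distrib-+ (λ c → 𝟙 (does (c ≟ x))) (λ c → whenUnused (x ∷ U) c 1) ⟩
    ∑[ c < n ] 𝟙 (does (c ≟ x)) + unusedCount (x ∷ U)                  ≡⟨ cong (_+ unusedCount (x ∷ U)) (sum-𝟙-≟ x) ⟩
    suc (unusedCount (x ∷ U))                                          ∎
    where
    open ≡-Reasoning
    split : ∀ c → whenUnused U c 1 ≡ 𝟙 (does (c ≟ x)) + whenUnused (x ∷ U) c 1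
    split c with c ≟ x | c ∈? U
    ... | yes refl | yes c∈U = ⊥-elim (x∉U c∈U)
    ... | yes refl | no  _   = refl
    ... | no  _    | yes _   = refl
    ... | no  _    | no  _   = refl

  sum-unused-preimage : ∀ {f : Fin n → Fin n} {U p b} → Injective _≡_ _≡_ f → p ∉ U → f p ≡ b →
    ∑[ c < n ] whenUnused U c (𝟙 (does (f c ≟ b))) ≡ 1
  sum-unused-preimage {f} {U} {p} {b} inj p∉U fp≡b = begin
    ∑[ c < n ] whenUnused U c (𝟙 (does (f c ≟ b)))  ≡⟨ sum-single _ p others ⟩
    whenUnused U p (𝟙 (does (f p ≟ b)))             ≡⟨ whenUnused-∉ p∉U ⟩
    𝟙 (does (f p ≟ b))                              ≡⟨ cong 𝟙 (dec-true (f p ≟ b) fp≡b) ⟩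
    1                                               ∎
    where
    open ≡-Reasoning
    others : ∀ c → c ≢ p → whenUnused U c (𝟙 (does (f c ≟ b))) ≡ 0
    others c c≢p = trans (whenUnused-cong {U} {c} λ _ → cong 𝟙 (dec-false (f c ≟ b) λ fc≡b → c≢p (inj (trans fc≡b (sym fp≡b))))) (whenUnused-0 {U} {c})

  sum-𝟙-preimage≤ : ∀ {P : Set} (p? : Dec P) {f : Fin n → Fin n} → Injective _≡_ _≡_ f → ∀ v →
    ∑[ c < n ] 𝟙 (does (p? ×-dec (v ≟ f c))) ≤ 𝟙 (does p?)
  sum-𝟙-preimage≤ (no _)  _   v = ≤-reflexive (sum-replicate-zero n)
  sum-𝟙-preimage≤ (yes _) {f} inj v = ≤-trans (sum-𝟙≤𝟙-any (λ c → does (v ≟ f c)) unique) (𝟙≤1 _)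
    where
    unique : ∀ {i j} → T (does (v ≟ f i)) → T (does (v ≟ f j)) → i ≡ j
    unique {i} {j} tᵢ tⱼ = inj (trans (sym (does-T (v ≟ f i) tᵢ)) (does-T (v ≟ f j) tⱼ))

  unusedCount-split : ∀ (b : Fin n → Bool) U →
    unusedCount U ≡ ∑[ c < n ] whenUnused U c (𝟙 (not (b c))) + ∑[ c < n ] whenUnused U c (𝟙 (b c))
  unusedCount-split b U = trans (sum-cong-≗ split) (∑-distrib-+ (λ c → whenUnused U c (𝟙 (not (b c)))) (λ c → whenUnused U c (𝟙 (b c))))
    where
    split : ∀ c → whenUnused U c 1 ≡ whenUnused U c (𝟙 (not (b c))) + whenUnused U c (𝟙 (b c))
    split c with c ∈? U | b c
    ... | yes _ | _     = refl
    ... | no  _ | true  = refl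
    ... | no  _ | false = refl

  sumRuns : (Fin n → Fin n) → List (Fin n) → List (Fin n) → Weight n → ℕ
  sumRuns g U []       w = w g
  sumRuns g U (x ∷ xs) w = ∑[ c < n ] whenUnused U c (sumRuns (swapAt g x c) (x ∷ U) xs w)

  -- Runs keep the map injective and never change it at positions already used.
  sumRuns-mono : ∀ {g U xs} {w w′ : Weight n} → Fresh U xs → Injective _≡_ _≡_ g →
    (∀ h → Injective _≡_ _≡_ h → (∀ {y} → y ∈ U → h y ≡ g y) → w h ≤ w′ h) →
    sumRuns g U xs w ≤ sumRuns g U xs w′
  sumRuns-mono {g} []         inj ok = ok g inj (λ _ → refl)
  sumRuns-mono {g} {U} (x∉U ∷ fr) inj ok = sum-mono-≤ λ c → whenUnused-mono {U} {c} λ c∉U →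
    sumRuns-mono fr (swapAt-injective _ c inj) λ h inj-h fixed → ok h inj-h λ y∈U →
      trans (fixed (there y∈U)) (swapAt-other g (λ { refl → x∉U y∈U }) (λ { refl → c∉U y∈U }))

  sumRuns-zero : ∀ g U xs → sumRuns g U xs (λ _ → 0) ≡ 0
  sumRuns-zero g U []       = refl
  sumRuns-zero g U (x ∷ xs) = sum-≗0 λ c → n≤0⇒n≡0 (≤-trans (whenUnused-≤ {U} {c}) (≤-reflexive (sumRuns-zero _ _ xs)))

  sumRuns-vanish : ∀ {g U xs} {w : Weight n} → Fresh U xs → Injective _≡_ _≡_ g →
    (∀ h → Injective _≡_ _≡_ h → (∀ {y} → y ∈ U → h y ≡ g y) → w h ≡ 0) → sumRuns g U xs w ≡ 0
  sumRuns-vanish {g} {U} {xs} fr inj w≡0 = n≤0⇒n≡0 (begin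
    sumRuns g U xs _          ≤⟨ sumRuns-mono fr inj (λ h inj-h fixed → ≤-reflexive (w≡0 h inj-h fixed)) ⟩
    sumRuns g U xs (λ _ → 0)  ≡⟨ sumRuns-zero g U xs ⟩
    0                         ∎)
    where open ≤-Reasoning

  sumRuns-sum : ∀ {k} (w : Fin k → Weight n) g U xs →
    ∑[ i < k ] sumRuns g U xs (w i) ≡ sumRuns g U xs (λ h → ∑[ i < k ] w i h)
  sumRuns-sum w g U []       = refl
  sumRuns-sum w g U (x ∷ xs) = trans (∑-comm (λ i c → whenUnused U c (sumRuns (swapAt g x c) (x ∷ U) xs (w i)))) (sum-cong-≗ λ c →
    trans (sum-whenUnused {U} {c} (λ i → sumRuns (swapAt g x c) (x ∷ U) xs (w i))) (whenUnused-cong {U} {c} λ _ → sumRuns-sum w (swapAt g x c) (x ∷ U) xs))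

  swapAt-∘ : ∀ (u : Fin n → Fin n) {g g′ : Fin n → Fin n} → (∀ y → g y ≡ u (g′ y)) →
    ∀ a b y → swapAt g a b y ≡ u (swapAt g′ a b y)
  swapAt-∘ u g≡u∘g′ a b y with does (y ≟ a)
  ... | true  = g≡u∘g′ b
  ... | false with does (y ≟ b)
  ...   | true  = g≡u∘g′ a
  ...   | false = g≡u∘g′ y

  sumRuns-relabel : ∀ (u : Fin n → Fin n) {w : Weight n} → (∀ {h h′} → h ≗ h′ → w h ≡ w h′) →
    ∀ {g g′} U xs → (∀ y → g y ≡ u (g′ y)) → sumRuns g U xs w ≡ sumRuns g′ U xs (w ∘ (u ∘_))
  sumRuns-relabel u w-ext U []       g≡u∘g′ = w-ext g≡u∘g′
  sumRuns-relabel u w-ext U (x ∷ xs) g≡u∘g′ = sum-cong-≗ λ c → whenUnused-cong {U} {c} λ _ →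
    sumRuns-relabel u w-ext (x ∷ U) xs (swapAt-∘ u g≡u∘g′ x c)

  P′≤sumRuns-1 : ∀ g {U xs} → Fresh U xs → unusedCount U P′ length xs ≤ sumRuns g U xs (λ _ → 1)
  P′≤sumRuns-1 g []                           = ≤-refl
  P′≤sumRuns-1 g {U} {x ∷ xs} (x∉U ∷ fr) = begin
    unusedCount U P′ suc (length xs)                   ≡⟨ cong (_P′ suc (length xs)) (unusedCount-∷ x∉U) ⟩
    suc M′ P′ suc (length xs)                          ≡⟨ P′-suc M′ (length xs) ⟩
    suc M′ * K                                         ≡⟨ cong (_* K) (unusedCount-∷ x∉U) ⟨
    unusedCount U * K                                  ≡⟨ *-distribʳ-sum K (λ c → whenUnused U c 1) ⟩
    ∑[ c < n ] (whenUnused U c 1 * K)                  ≤⟨ sum-mono-≤ (λ c → ≤-trans (≤-reflexive (whenUnused-*ʳ {U} {c} 1 K))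
                                                           (whenUnused-mono {U} {c} λ _ → ≤-trans (≤-reflexive (*-identityˡ K)) (P′≤sumRuns-1 _ fr))) ⟩
    sumRuns g U (x ∷ xs) (λ _ → 1)                     ∎
    where
    open ≤-Reasoning
    M′ = unusedCount (x ∷ U)
    K = M′ P′ length xs

  sumᴸ-allVecs≡sumRuns : ∀ {r} f U (xs : Vec (Fin n) r) (w : Weight n) →
    sumᴸ (λ cs → if admissibleFrom U xs cs then w (runSwap f xs cs) else 0) (allVecs n r)
      ≡ sumRuns f U (toList xs) w
  sumᴸ-allVecs≡sumRuns f U []       w = +-identityʳ (w f)
  sumᴸ-allVecs≡sumRuns {suc r} f U (x ∷ xs) w = begin
    sumᴸ h (concatMap (λ a → map (a ∷_) (allVecs n r)) (allFin n))  ≡⟨ sumᴸ-concatMap h _ (allFin n) ⟩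
    sumᴸ (λ a → sumᴸ h (map (a ∷_) (allVecs n r))) (allFin n)       ≡⟨ sumᴸ-tabulate (λ a → sumᴸ h (map (a ∷_) (allVecs n r))) id ⟩
    ∑[ a < n ] sumᴸ h (map (a ∷_) (allVecs n r))                     ≡⟨ sum-cong-≗ (λ a → trans (sumᴸ-map h (a ∷_) (allVecs n r)) (first-choice a)) ⟩
    sumRuns f U (x ∷ toList xs) w                                    ∎
    where
    open ≡-Reasoning
    h : Vec (Fin n) (suc r) → ℕ
    h cs = if admissibleFrom U (x ∷ xs) cs then w (runSwap f (x ∷ xs) cs) else 0
    first-choice : ∀ a →
      sumᴸ (λ cs → if not (elemᵇ a U) ∧ admissibleFrom (x ∷ U) xs cs then w (runSwap (swapAt f x a) xs cs) else 0) (allVecs n r)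
        ≡ whenUnused U a (sumRuns (swapAt f x a) (x ∷ U) (toList xs) w)
    first-choice a rewrite elemᵇ≡does-∈? a U with a ∈? U
    ... | yes _ = sumᴸ-0 (allVecs n r)
    ... | no  _ = sumᴸ-allVecs≡sumRuns (swapAt f x a) (x ∷ U) xs w

-- Pending target pairs

-- `off`: the target pair is already discharged; `free`: it is pending; `at y`: it is
-- pending and attached to the unprocessed position y, i.e. y = x′ⱼ or π y = y′ⱼ.
data Status (n : ℕ) : Set where
  off free : Status n
  at       : Fin n → Status n

isPending : ∀ {n} → Status n → Bool
isPending off    = false
isPending free   = true
isPending (at _) = true

at-injective : ∀ {n} {y z : Fin n} → at y ≡ at z → y ≡ z
at-injective refl = refl

_≟at_ : ∀ {n} (s : Status n) (y : Fin n) → Dec (s ≡ at y)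
off  ≟at y = no λ ()
free ≟at y = no λ ()
at z ≟at y = map′ (cong at) at-injective (z ≟ y)

release : ∀ {n} → Fin n → Status n → Status n
release x off    = off
release x free   = free
release x (at y) = if does (y ≟ x) then free else at y

module _ {n : ℕ} where

  isPending-release : ∀ (x : Fin n) s → isPending (release x s) ≡ isPending s
  isPending-release x off    = refl
  isPending-release x free   = refl
  isPending-release x (at y) with does (y ≟ x)
  ... | true  = refl
  ... | false = refl

  release-at : ∀ {x z : Fin n} s → release x s ≡ at z → s ≡ at z × z ≢ x
  release-at {x} (at y) eq with y ≟ x
  release-at     (at y) refl | no y≢x = refl , y≢x

  release-keep : ∀ {x z : Fin n} → z ≢ x → release x (at z) ≡ at z
  release-keep {x} {z} z≢x rewrite dec-false (z ≟ x) z≢x = refl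

module Targets {n q : ℕ} (x′ y′ : Fin q → Fin n)
  (x′-injective : Injective _≡_ _≡_ x′) (y′-injective : Injective _≡_ _≡_ y′) where

  States : Set
  States = Fin q → Status n

  Pending : Status n → Set
  Pending s = T (isPending s)

  Satisfies : States → (Fin n → Fin n) → Set
  Satisfies st h = ∀ j → Pending (st j) → h (x′ j) ≡ y′ j

  satisfies? : ∀ st h → Dec (Satisfies st h)
  satisfies? st h = all? λ j → T? (isPending (st j)) →-dec (h (x′ j) ≟ y′ j)

  sat : States → Weight n
  sat st h = 𝟙 (does (satisfies? st h))

  sat-cong : ∀ st {h h′} → h ≗ h′ → sat st h ≡ sat st h′
  sat-cong st {h} {h′} h≗h′ =
    ≤-antisym (𝟙-does-mono (satisfies? st h) (satisfies? st h′) λ s j pj → trans (sym (h≗h′ (x′ j))) (s j pj))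
              (𝟙-does-mono (satisfies? st h′) (satisfies? st h) λ s j pj → trans (h≗h′ (x′ j)) (s j pj))

  pendingCount : States → ℕ
  pendingCount st = ∑[ j < q ] 𝟙 (isPending (st j))

  Attached : States → Fin n → Set
  Attached st y = ∃ λ j → st j ≡ at y

  attached? : ∀ st y → Dec (Attached st y)
  attached? st y = any? λ j → st j ≟at y

  attachedCount : States → List (Fin n) → ℕ
  attachedCount st = sumᴸ (λ y → 𝟙 (does (attached? st y)))

  isTarget : States → Fin n → Fin q → Bool
  isTarget st v j = isPending (st j) ∧ does (v ≟ y′ j)

  Target : States → Fin n → Set
  Target st v = ∃ λ j → T (isTarget st v j)

  target? : ∀ st v → Dec (Target st v)
  target? st v = any? (T? ∘ isTarget st v)

  target-elim : ∀ {st v j} → T (isTarget st v j) → Pending (st j) × v ≡ y′ j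
  target-elim {st} {v} {j} t = let (pj , t′) = Equivalence.to T-∧ t in pj , does-T (v ≟ y′ j) t′

  target-intro : ∀ {st v} j → Pending (st j) → v ≡ y′ j → Target st v
  target-intro {v = v} j pj v≡y′j = j , Equivalence.from T-∧ (pj , T-does (v ≟ y′ j) v≡y′j)

  record Invariant (π : Fin n → Fin n) (U xs : List (Fin n)) (st : States) : Set where
    field
      injective : Injective _≡_ _≡_ π
      fresh     : Fresh U xs
      preimage  : ∀ j → Pending (st j) → ∃ λ p → p ∉ U × π p ≡ y′ j
      attached  : ∀ {j y} → st j ≡ at y → y ≡ x′ j ⊎ π y ≡ y′ j

  Fits : List (Fin n) → List (Fin n) → States → Set
  Fits U xs st = pendingCount st + (length xs ∸ attachedCount st xs) ≤ unusedCount U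

  runBound : List (Fin n) → List (Fin n) → States → ℕ
  runBound U xs st = (unusedCount U ∸ pendingCount st) P′ (length xs ∸ attachedCount st xs)

  Bound : List (Fin n) → Set
  Bound xs = ∀ {π U st} → Invariant π U xs st → Fits U xs st → sumRuns π U xs (sat st) ≤ runBound U xs st

  pendingCount-drop : ∀ {st st′ k} → Pending (st k) → ¬ Pending (st′ k) →
    (∀ j → j ≢ k → isPending (st′ j) ≡ isPending (st j)) → pendingCount st ≡ suc (pendingCount st′)
  pendingCount-drop {st} {st′} {k} pk ¬pk′ others = begin
    ∑[ j < q ] 𝟙 (isPending (st j))                           ≡⟨ sum-cong-≗ split ⟩
    ∑[ j < q ] (𝟙 (does (j ≟ k)) + 𝟙 (isPending (st′ j)))     ≡⟨ ∑-distrib-+ (λ j → 𝟙 (does (j ≟ k))) (λ j → 𝟙 (isPending (st′ j))) ⟩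
    ∑[ j < q ] 𝟙 (does (j ≟ k)) + pendingCount st′            ≡⟨ cong (_+ pendingCount st′) (sum-𝟙-≟ k) ⟩
    suc (pendingCount st′)                                    ∎
    where
    open ≡-Reasoning
    split : ∀ j → 𝟙 (isPending (st j)) ≡ 𝟙 (does (j ≟ k)) + 𝟙 (isPending (st′ j))
    split j with j ≟ k
    ... | yes refl = trans (𝟙-T pk) (cong suc (sym (𝟙-≡0 ¬pk′)))
    ... | no  j≢k  = cong 𝟙 (sym (others j j≢k))

  attachedCount-mono : ∀ {st st′} xs → (∀ {z} → z ∈ xs → Attached st z → Attached st′ z) →
    attachedCount st xs ≤ attachedCount st′ xs
  attachedCount-mono {st} {st′} xs keep = sumᴸ-mono-≤ xs λ z∈xs → 𝟙-does-mono (attached? st _) (attached? st′ _) (keep z∈xs)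

  attachedCount-mono-except : ∀ {st st′ y U} xs → Fresh U xs →
    (∀ {z} → z ∈ xs → z ≢ y → Attached st z → Attached st′ z) → attachedCount st xs ≤ suc (attachedCount st′ xs)
  attachedCount-mono-except []       _            _    = z≤n
  attachedCount-mono-except {st} {st′} {y} (z ∷ xs) (_ ∷ fr) keep with z ≟ y
  ... | yes refl = +-mono-≤ (𝟙≤1 _) (≤-trans (attachedCount-mono xs (λ w∈xs → keep (there w∈xs) (λ { refl → ∈⇒∉-Fresh fr (here refl) w∈xs })))
                                              (m≤n+m _ _))
  ... | no  z≢y  = ≤-trans (+-mono-≤ (𝟙-does-mono (attached? st z) (attached? st′ z) (keep (here refl) z≢y))
                                     (attachedCount-mono-except xs fr (keep ∘ there)))
                           (≤-reflexive (+-suc _ _))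

  discharge : Fin q → Fin n → States → States
  discharge k x st j = if does (j ≟ k) then off else release x (st j)

  discharge-self : ∀ k x st → discharge k x st k ≡ off
  discharge-self k x st rewrite dec-true (k ≟ k) refl = refl

  discharge-other : ∀ {k j} x st → j ≢ k → discharge k x st j ≡ release x (st j)
  discharge-other {k} {j} x st j≢k rewrite dec-false (j ≟ k) j≢k = refl

  discharge-pending : ∀ {k x st j} → Pending (discharge k x st j) → j ≢ k × Pending (st j)
  discharge-pending {k} {x} {st} {j} pj with j ≟ k
  ... | no  j≢k = j≢k , subst T (isPending-release x (st j)) pj

  discharge-at : ∀ {k x st j z} → discharge k x st j ≡ at z → j ≢ k × st j ≡ at z × z ≢ x
  discharge-at {k} {x} {st} {j} eq with j ≟ k
  ... | no j≢k = j≢k , release-at (st j) eq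

  pendingCount-discharge : ∀ {k} x st → Pending (st k) → pendingCount st ≡ suc (pendingCount (discharge k x st))
  pendingCount-discharge {k} x st pk = pendingCount-drop pk (subst Pending (discharge-self k x st))
    λ j j≢k → trans (cong isPending (discharge-other x st j≢k)) (isPending-release x (st j))

  discharge-keeps : ∀ {U x xs st k z} → Fresh U (x ∷ xs) → z ∈ xs →
    (∀ {j} → st j ≡ at z → j ≢ k) → Attached st z → Attached (discharge k x st) z
  discharge-keeps {x = x} {st = st} {z = z} fr z∈xs ≢k (j , stj) =
    j , trans (discharge-other x st (≢k stj)) (trans (cong (release x) stj) (release-keep z≢x))
    where
    z≢x : z ≢ x
    z≢x refl = head∉tail-Fresh fr z∈xs

  attachedCount-discharge : ∀ {U x xs st k} → Fresh U (x ∷ xs) → (∀ {z} → z ∈ xs → st k ≢ at z) →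
    attachedCount st (x ∷ xs) ≤ suc (attachedCount (discharge k x st) xs)
  attachedCount-discharge {xs = xs} fr k∉xs = +-mono-≤ (𝟙≤1 _)
    (attachedCount-mono xs λ z∈xs → discharge-keeps fr z∈xs λ stj → λ { refl → k∉xs z∈xs stj })

  boundAfterDischarge : ∀ {x xs U st π′ st′} → Bound xs → Invariant π′ (x ∷ U) xs st′ → x ∉ U →
    pendingCount st ≡ suc (pendingCount st′) → attachedCount st (x ∷ xs) ≤ suc (attachedCount st′ xs) →
    Fits U (x ∷ xs) st → sumRuns π′ (x ∷ U) xs (sat st′) ≤ runBound U (x ∷ xs) st
  boundAfterDischarge {x} {xs} {U} {st} {π′} {st′} IH I′ x∉U q≡1+q′ S≤1+s′ fits = begin
    sumRuns π′ (x ∷ U) xs (sat st′)                             ≤⟨ IH I′ (shrink-fits fits′ S≤1+s′) ⟩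
    (M′ ∸ q′) P′ (length xs ∸ attachedCount st′ xs)             ≤⟨ shrink-bound fits′ S≤1+s′ ⟩
    (M′ ∸ q′) P′ (suc (length xs) ∸ attachedCount st (x ∷ xs))  ≡⟨ cong₂ (λ M q → (M ∸ q) P′ (suc (length xs) ∸ attachedCount st (x ∷ xs))) (unusedCount-∷ x∉U) q≡1+q′ ⟨
    runBound U (x ∷ xs) st                                      ∎
    where
    open ≤-Reasoning
    M′ = unusedCount (x ∷ U)
    q′ = pendingCount st′
    fits′ : suc q′ + (suc (length xs) ∸ attachedCount st (x ∷ xs)) ≤ suc M′
    fits′ = subst₂ (λ q M → q + (suc (length xs) ∸ attachedCount st (x ∷ xs)) ≤ M) q≡1+q′ (unusedCount-∷ x∉U) fits

  attached-swapAt : ∀ {π U xs st x k p} → Invariant π U xs st → π p ≡ y′ k →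
    ∀ {j z} → j ≢ k → st j ≡ at z → z ≢ x → z ≡ x′ j ⊎ swapAt π x p z ≡ y′ j
  attached-swapAt {π} I πp≡y′k j≢k stj z≢x with Invariant.attached I stj
  ... | inj₁ z≡x′j  = inj₁ z≡x′j
  ... | inj₂ πz≡y′j = inj₂ (trans (swapAt-other π z≢x λ { refl → j≢k (y′-injective (trans (sym πz≡y′j) πp≡y′k)) }) πz≡y′j)

  forcedChoice : ∀ {π : Fin n → Fin n} {st x U c p k} → Injective _≡_ _≡_ π → Pending (st k) → x′ k ≡ x → π p ≡ y′ k →
    ∀ h → (∀ {y} → y ∈ x ∷ U → h y ≡ swapAt π x c y) → Satisfies st h → c ≡ p
  forcedChoice {π} {st} {x} {U} {c} {p} {k} inj pk x′k≡x πp≡y′k h fixed s = inj (begin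
    π c             ≡⟨ swapAt-at₁ π x c ⟨
    swapAt π x c x  ≡⟨ fixed (here refl) ⟨
    h x             ≡⟨ cong h x′k≡x ⟨
    h (x′ k)        ≡⟨ s k pk ⟩
    y′ k            ≡⟨ πp≡y′k ⟨
    π p             ∎)
    where open ≡-Reasoning

  -- If x = x′ₖ for a pending k, only the choice bringing y′ₖ to x can contribute.
  forcedStep : ∀ {x xs π U st} → Bound xs → Invariant π U (x ∷ xs) st → Fits U (x ∷ xs) st →
    ∀ {k} → Pending (st k) → x′ k ≡ x → ∀ {p} → p ∉ U → π p ≡ y′ k → ∀ st′ →
    (∀ j → Pending (st′ j) → j ≢ k × Pending (st j)) → pendingCount st ≡ suc (pendingCount st′) →
    attachedCount st (x ∷ xs) ≤ suc (attachedCount st′ xs) →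
    (∀ {j z} → st′ j ≡ at z → z ≡ x′ j ⊎ swapAt π x p z ≡ y′ j) →
    sumRuns π U (x ∷ xs) (sat st) ≤ runBound U (x ∷ xs) st
  forcedStep {x} {xs} {π} {U} {st} IH I fits {k} pk x′k≡x {p} p∉U πp≡y′k st′ sub q≡1+q′ S≤1+s′ att′ = begin
    sumRuns π U (x ∷ xs) (sat st)                                ≡⟨ sum-single _ p others ⟩
    whenUnused U p (sumRuns (swapAt π x p) (x ∷ U) xs (sat st))  ≡⟨ whenUnused-∉ p∉U ⟩
    sumRuns (swapAt π x p) (x ∷ U) xs (sat st)                   ≤⟨ sumRuns-mono fr (swapAt-injective x p injective) weaken ⟩
    sumRuns (swapAt π x p) (x ∷ U) xs (sat st′)                  ≤⟨ boundAfterDischarge IH I′ (Fresh-head fresh) q≡1+q′ S≤1+s′ fits ⟩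
    runBound U (x ∷ xs) st                                       ∎
    where
    open ≤-Reasoning
    open Invariant I
    fr = Fresh-tail fresh

    others : ∀ c → c ≢ p → whenUnused U c (sumRuns (swapAt π x c) (x ∷ U) xs (sat st)) ≡ 0
    others c c≢p = n≤0⇒n≡0 (≤-trans (whenUnused-≤ {U = U} {c = c}) (≤-reflexive (sumRuns-vanish fr (swapAt-injective x c injective)
      λ h _ fixed → cong 𝟙 (dec-false (satisfies? st h) (c≢p ∘ forcedChoice injective pk x′k≡x πp≡y′k h fixed)))))

    weaken : ∀ h → Injective _≡_ _≡_ h → (∀ {y} → y ∈ x ∷ U → h y ≡ swapAt π x p y) → sat st h ≤ sat st′ h
    weaken h _ _ = 𝟙-does-mono (satisfies? st h) (satisfies? st′ h) λ s j pj → s j (proj₂ (sub j pj))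

    I′ : Invariant (swapAt π x p) (x ∷ U) xs st′
    I′ = record
      { injective = swapAt-injective x p injective
      ; fresh     = fr
      ; preimage  = λ j pj′ → let (j≢k , pj) = sub j pj′ ; (pⱼ , pⱼ∉U , πpⱼ≡y′j) = preimage j pj in
          preimage-swapAt πpⱼ≡y′j pⱼ∉U p∉U λ pⱼ≡p → j≢k (y′-injective (trans (sym πpⱼ≡y′j) (trans (cong π pⱼ≡p) πp≡y′k)))
      ; attached  = att′
      }

  forcedDischarge : ∀ {x xs π U st} → Bound xs → Invariant π U (x ∷ xs) st → Fits U (x ∷ xs) st →
    ∀ {k} → Pending (st k) → x′ k ≡ x → attachedCount st (x ∷ xs) ≤ suc (attachedCount (discharge k x st) xs) →
    sumRuns π U (x ∷ xs) (sat st) ≤ runBound U (x ∷ xs) st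
  forcedDischarge {x} {st = st} IH I fits {k} pk x′k≡x S≤1+s′ with Invariant.preimage I k pk
  ... | p , p∉U , πp≡y′k = forcedStep IH I fits pk x′k≡x p∉U πp≡y′k (discharge k x st)
    (λ j → discharge-pending {k} {x} {st}) (pendingCount-discharge x st pk) S≤1+s′
    λ eq → let (j≢k , stj , z≢x) = discharge-at {k} {x} {st} eq in attached-swapAt I πp≡y′k j≢k stj z≢x

  -- Target k is discharged at x; the target l attached to x moves to y, where the exchange puts π x.
  reattach : Fin q → Fin q → Fin n → Fin n → States → States
  reattach k l y x st j = if does (j ≟ k) then off else if does (j ≟ l) then at y else release x (st j)

  reattach-self : ∀ {k l y x st} → reattach k l y x st k ≡ off
  reattach-self {k} rewrite dec-true (k ≟ k) refl = refl

  reattach-moved : ∀ {k l y x st} → l ≢ k → reattach k l y x st l ≡ at y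
  reattach-moved {k} {l} l≢k rewrite dec-false (l ≟ k) l≢k | dec-true (l ≟ l) refl = refl

  reattach-other : ∀ {k l y x st j} → j ≢ k → j ≢ l → reattach k l y x st j ≡ release x (st j)
  reattach-other {k} {l} {j = j} j≢k j≢l rewrite dec-false (j ≟ k) j≢k | dec-false (j ≟ l) j≢l = refl

  reattach-pending : ∀ {k l y x st j} → st l ≡ at x → Pending (reattach k l y x st j) → j ≢ k × Pending (st j)
  reattach-pending {k} {l} {y} {x} {st} {j} stl pj′ with j ≟ k | j ≟ l
  ... | no j≢k | yes refl = j≢k , subst Pending (sym stl) _
  ... | no j≢k | no  _    = j≢k , subst T (isPending-release x (st j)) pj′

  pendingCount-reattach : ∀ {k l y x st} → Pending (st k) → st l ≡ at x →
    pendingCount st ≡ suc (pendingCount (reattach k l y x st))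
  pendingCount-reattach {k} {l} {y} {x} {st} pk stl = pendingCount-drop pk (subst Pending (reattach-self {k} {l} {y} {x} {st})) same
    where
    same : ∀ j → j ≢ k → isPending (reattach k l y x st j) ≡ isPending (st j)
    same j j≢k rewrite dec-false (j ≟ k) j≢k with j ≟ l
    ... | yes refl = cong isPending (sym stl)
    ... | no  _    = isPending-release x (st j)

  attachedCount-reattach : ∀ {U x xs st k l y} → Fresh U (x ∷ xs) → st k ≡ at y → st l ≡ at x → l ≢ k →
    attachedCount st (x ∷ xs) ≤ suc (attachedCount (reattach k l y x st) xs)
  attachedCount-reattach {U} {x} {xs} {st} {k} {l} {y} fr stk stl l≢k = +-mono-≤ (𝟙≤1 _) (attachedCount-mono xs keep)
    where
    keep : ∀ {z} → z ∈ xs → Attached st z → Attached (reattach k l y x st) z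
    keep {z} z∈xs (j , stj) with j ≟ k
    ... | yes refl = l , trans (reattach-moved {k} {l} {y} {x} {st} l≢k) (cong at (at-injective (trans (sym stk) stj)))
    ... | no  j≢k  = j , trans (reattach-other {k} {l} {y} {x} {st} j≢k j≢l) (trans (cong (release x) stj) (release-keep z≢x))
      where
      z≢x : z ≢ x
      z≢x refl = head∉tail-Fresh fr z∈xs
      j≢l : j ≢ l
      j≢l refl = z≢x (at-injective (trans (sym stj) stl))

  forcedReattach : ∀ {x xs π U st} → Bound xs → Invariant π U (x ∷ xs) st → Fits U (x ∷ xs) st →
    ∀ {k y l} → x′ k ≡ x → st k ≡ at y → y ≢ x → st l ≡ at x →
    sumRuns π U (x ∷ xs) (sat st) ≤ runBound U (x ∷ xs) st
  forcedReattach {x} {xs} {π} {U} {st} IH I fits {k} {y} {l} x′k≡x stk y≢x stl =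
    forcedStep IH I fits pk x′k≡x p∉U πp≡y′k (reattach k l y x st) (λ j → reattach-pending {k} {l} {y} {x} {st} {j} stl)
      (pendingCount-reattach {k} {l} {y} pk stl) (attachedCount-reattach fresh stk stl l≢k) att′
    where
    open Invariant I

    pk : Pending (st k)
    pk = subst Pending (sym stk) _

    p = proj₁ (preimage k pk)
    p∉U = proj₁ (proj₂ (preimage k pk))
    πp≡y′k = proj₂ (proj₂ (preimage k pk))

    l≢k : l ≢ k
    l≢k refl = y≢x (at-injective (trans (sym stk) stl))

    p≡y : p ≡ y
    p≡y with attached stk
    ... | inj₁ y≡x′k  = ⊥-elim (y≢x (trans y≡x′k x′k≡x))
    ... | inj₂ πy≡y′k = injective (trans πp≡y′k (sym πy≡y′k))

    πx≡y′l : π x ≡ y′ l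
    πx≡y′l with attached stl
    ... | inj₁ x≡x′l  = ⊥-elim (l≢k (x′-injective (trans (sym x≡x′l) (sym x′k≡x))))
    ... | inj₂ πx≡y′l = πx≡y′l

    att′ : ∀ {j z} → reattach k l y x st j ≡ at z → z ≡ x′ j ⊎ swapAt π x p z ≡ y′ j
    att′ {j} {z} eq with j ≟ k | j ≟ l
    ... | no _   | yes refl = inj₂ (begin
      swapAt π x p z  ≡⟨ cong (swapAt π x p) (trans (at-injective (sym eq)) (sym p≡y)) ⟩
      swapAt π x p p  ≡⟨ swapAt-at₂ π x p ⟩
      π x             ≡⟨ πx≡y′l ⟩
      y′ j            ∎)
      where open ≡-Reasoning
    ... | no j≢k | no _     = let (stj , z≢x) = release-at (st j) eq in attached-swapAt I πp≡y′k j≢k stj z≢x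

  forced : ∀ {x xs π U st} → Bound xs → Invariant π U (x ∷ xs) st → Fits U (x ∷ xs) st →
    ∀ {k} → Pending (st k) → x′ k ≡ x → sumRuns π U (x ∷ xs) (sat st) ≤ runBound U (x ∷ xs) st
  forced {x} {xs} {π} {U} {st} IH I fits {k} pk x′k≡x = byStatus (st k) refl
    where
    fr = Invariant.fresh I

    byStatus : ∀ s → st k ≡ s → sumRuns π U (x ∷ xs) (sat st) ≤ runBound U (x ∷ xs) st
    byStatus off    stk = ⊥-elim (subst Pending stk pk)
    byStatus free   stk = forcedDischarge IH I fits pk x′k≡x (attachedCount-discharge fr λ _ stk′ → free≢at (trans (sym stk) stk′))
      where
      free≢at : ∀ {z} → free ≢ at z
      free≢at ()
    byStatus (at y) stk with y ≟ x
    ... | yes refl = forcedDischarge IH I fits pk x′k≡x (attachedCount-discharge fr λ z∈xs stk′ →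
                       head∉tail-Fresh fr (subst (_∈ xs) (at-injective (trans (sym stk′) stk)) z∈xs))
    ... | no y≢x = byAttachment (attached? st x)
      where
      open ≤-Reasoning
      keep : ∀ {z} → z ∈ xs → z ≢ y → Attached st z → Attached (discharge k x st) z
      keep z∈xs z≢y = discharge-keeps fr z∈xs λ stj → λ { refl → z≢y (at-injective (trans (sym stj) stk)) }

      byAttachment : Dec (Attached st x) → sumRuns π U (x ∷ xs) (sat st) ≤ runBound U (x ∷ xs) st
      byAttachment (yes (l , stl)) = forcedReattach IH I fits x′k≡x stk y≢x stl
      -- The attachment of k to y is lost, but x itself is not attached.
      byAttachment (no unattached) = forcedDischarge IH I fits pk x′k≡x (begin
        𝟙 (does (attached? st x)) + attachedCount st xs  ≡⟨ cong (λ b → 𝟙 b + attachedCount st xs) (dec-false (attached? st x) unattached) ⟩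
        attachedCount st xs                              ≤⟨ attachedCount-mono-except xs (Fresh-tail fr) keep ⟩
        suc (attachedCount (discharge k x st) xs)        ∎)

  relabelled-target : ∀ {x : Fin n} {π : Fin n → Fin n} {st l} → (∀ k → Pending (st k) → x′ k ≢ x) → Pending (st l) → π x ≡ y′ l →
    ∀ c h → Injective _≡_ _≡_ h → h x ≡ π x → Satisfies st (transpose (π x) (π c) ∘ h) →
    Satisfies (discharge l x st) h × h (x′ l) ≡ π c
  relabelled-target {x} {π} {st} {l} notForced pl πx≡y′l c h inj-h hx≡πx s = satisfied′ , hx′l≡πc
    where
    solved : ∀ j → Pending (st j) → h (x′ j) ≡ transpose (π c) (π x) (y′ j)
    solved j pj = transpose-solve (s j pj)

    hx′l≡πc : h (x′ l) ≡ π c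
    hx′l≡πc = trans (solved l pl) (trans (cong (transpose (π c) (π x)) (sym πx≡y′l)) (transpose-at₂ (π c) (π x)))

    satisfied′ : Satisfies (discharge l x st) h
    satisfied′ j pj′ with discharge-pending {l} {x} {st} pj′
    ... | j≢l , pj with y′ j ≟ π c
    ...   | yes y′j≡πc = ⊥-elim (notForced j pj (inj-h (trans (solved j pj)
                           (trans (cong (transpose (π c) (π x)) y′j≡πc) (trans (transpose-at₁ (π c) (π x)) (sym hx≡πx))))))
    ...   | no  y′j≢πc = trans (solved j pj) (transpose-other y′j≢πc λ y′j≡πx → j≢l (y′-injective (trans y′j≡πx πx≡y′l)))

  -- Relabelling values by the transposition of π x and π c turns a run from the choice c into a
  -- run from π in which y′ₗ ends at the position of π c.
  sumRuns-relabelled : ∀ {π U x xs st l} → Injective _≡_ _≡_ π → Fresh (x ∷ U) xs →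
    (∀ k → Pending (st k) → x′ k ≢ x) → Pending (st l) → π x ≡ y′ l → ∀ c →
    sumRuns (swapAt π x c) (x ∷ U) xs (sat st)
      ≤ sumRuns π (x ∷ U) xs (λ h → 𝟙 (does (satisfies? (discharge l x st) h ×-dec (h (x′ l) ≟ π c))))
  sumRuns-relabelled {π} {U} {x} {xs} {st} {l} inj fr notForced pl πx≡y′l c = begin
    sumRuns (swapAt π x c) (x ∷ U) xs (sat st)  ≡⟨ sumRuns-relabel u (sat-cong st) (x ∷ U) xs (swapAt≡transpose inj x c) ⟩
    sumRuns π (x ∷ U) xs (sat st ∘ (u ∘_))      ≤⟨ sumRuns-mono fr inj transported ⟩
    _                                           ∎
    where
    open ≤-Reasoning
    u = transpose (π x) (π c)
    transported : ∀ h → Injective _≡_ _≡_ h → (∀ {y} → y ∈ x ∷ U → h y ≡ π y) →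
      sat st (u ∘ h) ≤ 𝟙 (does (satisfies? (discharge l x st) h ×-dec (h (x′ l) ≟ π c)))
    transported h inj-h fixed = 𝟙-does-mono (satisfies? st (u ∘ h)) (satisfies? (discharge l x st) h ×-dec (h (x′ l) ≟ π c))
      (relabelled-target {x} {π} {st} {l} notForced pl πx≡y′l c h inj-h (fixed (here refl)))

  Invariant-discharge-attached : ∀ {π U x xs st l} → Invariant π U (x ∷ xs) st → π x ≡ y′ l →
    Invariant π (x ∷ U) xs (discharge l x st)
  Invariant-discharge-attached {π} {U} {x} {xs} {st} {l} I πx≡y′l = record
    { injective = injective
    ; fresh     = Fresh-tail fresh
    ; preimage  = λ j pj′ → let (j≢l , pj) = discharge-pending {l} {x} {st} pj′ ; (p , p∉U , πp≡y′j) = preimage j pj in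
        p , (λ { (here p≡x) → j≢l (y′-injective (trans (sym πp≡y′j) (trans (cong π p≡x) πx≡y′l))) ; (there p∈U) → p∉U p∈U }) , πp≡y′j
    ; attached  = λ eq → let (_ , stj , _) = discharge-at {l} {x} {st} eq in attached stj
    }
    where open Invariant I

  -- If x is attached to the target l but is no pending x′ₖ, summing over the choices costs no
  -- more than discharging l.
  attachedStep : ∀ {x xs π U st} → Bound xs → Invariant π U (x ∷ xs) st → Fits U (x ∷ xs) st →
    (∀ k → Pending (st k) → x′ k ≢ x) → ∀ {l} → st l ≡ at x →
    sumRuns π U (x ∷ xs) (sat st) ≤ runBound U (x ∷ xs) st
  attachedStep {x} {xs} {π} {U} {st} IH I fits notForced {l} stl = begin
    sumRuns π U (x ∷ xs) (sat st)                  ≤⟨ sum-mono-≤ (λ c → ≤-trans (whenUnused-≤ {U = U} {c = c})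
                                                        (sumRuns-relabelled injective fr notForced pl πx≡y′l c)) ⟩
    ∑[ c < n ] sumRuns π (x ∷ U) xs (w c)          ≡⟨ sumRuns-sum w π (x ∷ U) xs ⟩
    sumRuns π (x ∷ U) xs (λ h → ∑[ c < n ] w c h)  ≤⟨ sumRuns-mono fr injective (λ h _ _ → sum-𝟙-preimage≤ (satisfies? st′ h) injective (h (x′ l))) ⟩
    sumRuns π (x ∷ U) xs (sat st′)                 ≤⟨ boundAfterDischarge IH (Invariant-discharge-attached I πx≡y′l) (Fresh-head fresh)
                                                        (pendingCount-discharge x st pl) S≤1+s′ fits ⟩
    runBound U (x ∷ xs) st                         ∎
    where
    open ≤-Reasoning
    open Invariant I
    fr = Fresh-tail fresh
    st′ = discharge l x st

    pl : Pending (st l)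
    pl = subst Pending (sym stl) _

    πx≡y′l : π x ≡ y′ l
    πx≡y′l with attached stl
    ... | inj₁ x≡x′l  = ⊥-elim (notForced l pl (sym x≡x′l))
    ... | inj₂ πx≡y′l = πx≡y′l

    w : Fin n → Weight n
    w c h = 𝟙 (does (satisfies? st′ h ×-dec (h (x′ l) ≟ π c)))

    S≤1+s′ : attachedCount st (x ∷ xs) ≤ suc (attachedCount st′ xs)
    S≤1+s′ = attachedCount-discharge fresh λ z∈xs stlz → head∉tail-Fresh fresh (subst (_∈ xs) (at-injective (trans (sym stlz) stl)) z∈xs)

  pendingCount≤unusedTargets : ∀ {π U xs st} → Invariant π U xs st →
    pendingCount st ≤ ∑[ c < n ] whenUnused U c (𝟙 (does (target? st (π c))))
  pendingCount≤unusedTargets {π} {U} {xs} {st} I = begin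
    ∑[ j < q ] 𝟙 (isPending (st j))                                        ≡⟨ sum-cong-≗ (λ j → viaPreimage (isPending (st j)) (preimage j)) ⟩
    ∑[ j < q ] ∑[ c < n ] whenUnused U c (𝟙 (isTarget st (π c) j))        ≡⟨ ∑-comm (λ j c → whenUnused U c (𝟙 (isTarget st (π c) j))) ⟩
    ∑[ c < n ] ∑[ j < q ] whenUnused U c (𝟙 (isTarget st (π c) j))        ≡⟨ sum-cong-≗ (λ c → sum-whenUnused {U = U} {c = c} (𝟙 ∘ isTarget st (π c))) ⟩
    ∑[ c < n ] whenUnused U c (∑[ j < q ] 𝟙 (isTarget st (π c) j))        ≤⟨ sum-mono-≤ (λ c → whenUnused-mono {U = U} {c = c} λ _ →
                                                                               sum-𝟙≤𝟙-any (isTarget st (π c)) (λ {i} {j} → unique {π c} {i} {j})) ⟩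
    ∑[ c < n ] whenUnused U c (𝟙 (does (target? st (π c))))               ∎
    where
    open ≤-Reasoning
    open Invariant I
    viaPreimage : ∀ {j} b → (T b → ∃ λ p → p ∉ U × π p ≡ y′ j) →
      𝟙 b ≡ ∑[ c < n ] whenUnused U c (𝟙 (b ∧ does (π c ≟ y′ j)))
    viaPreimage false _   = sym (sum-≗0 λ c → whenUnused-0 {U = U} {c = c})
    viaPreimage true  pre = let (p , p∉U , πp≡y′j) = pre _ in sym (sum-unused-preimage injective p∉U πp≡y′j)
    unique : ∀ {v i j} → T (isTarget st v i) → T (isTarget st v j) → i ≡ j
    unique {v} {i} {j} tᵢ tⱼ = y′-injective (trans (sym (proj₂ (target-elim {st} {v} {i} tᵢ))) (proj₂ (target-elim {st} {v} {j} tⱼ)))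

  unusedNonTargets+pendingCount≤unusedCount : ∀ {π U xs st} → Invariant π U xs st →
    ∑[ c < n ] whenUnused U c (𝟙 (not (does (target? st (π c))))) + pendingCount st ≤ unusedCount U
  unusedNonTargets+pendingCount≤unusedCount {π} {U} {st = st} I = begin
    nonTargets + pendingCount st                                            ≤⟨ +-monoʳ-≤ nonTargets (pendingCount≤unusedTargets I) ⟩
    nonTargets + ∑[ c < n ] whenUnused U c (𝟙 (does (target? st (π c))))   ≡⟨ unusedCount-split (λ c → does (target? st (π c))) U ⟨
    unusedCount U                                                           ∎
    where
    open ≤-Reasoning
    nonTargets = ∑[ c < n ] whenUnused U c (𝟙 (not (does (target? st (π c)))))

  Invariant-swapAt-nonTarget : ∀ {π U x xs st c} → Invariant π U (x ∷ xs) st → ¬ Attached st x →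
    c ∉ U → ¬ Target st (π c) → Invariant (swapAt π x c) (x ∷ U) xs st
  Invariant-swapAt-nonTarget {π} {U} {x} {xs} {st} {c} I unattached c∉U nonTarget = record
    { injective = swapAt-injective x c injective
    ; fresh     = Fresh-tail fresh
    ; preimage  = λ j pj → let (p , p∉U , πp≡y′j) = preimage j pj in
        preimage-swapAt πp≡y′j p∉U c∉U λ { refl → nonTarget (target-intro j pj πp≡y′j) }
    ; attached  = attached′
    }
    where
    open Invariant I
    attached′ : ∀ {j z} → st j ≡ at z → z ≡ x′ j ⊎ swapAt π x c z ≡ y′ j
    attached′ {j} {z} stj with attached stj
    ... | inj₁ z≡x′j  = inj₁ z≡x′j
    ... | inj₂ πz≡y′j = inj₂ (trans (swapAt-other π (λ { refl → unattached (j , stj) })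
                                (λ { refl → nonTarget (target-intro j (subst Pending (sym stj) _) πz≡y′j) })) πz≡y′j)

  -- Bringing a pending y′ⱼ to x, which is never visited again, rules out meeting target j unless x = x′ⱼ.
  sumRuns-target-vanish : ∀ {π U x xs st c} → Injective _≡_ _≡_ π → Fresh (x ∷ U) xs →
    (∀ k → Pending (st k) → x′ k ≢ x) → Target st (π c) → sumRuns (swapAt π x c) (x ∷ U) xs (sat st) ≡ 0
  sumRuns-target-vanish {π} {x = x} {st = st} {c} inj fr notForced (j , t) =
    sumRuns-vanish fr (swapAt-injective x c inj) λ h inj-h fixed → cong 𝟙 (dec-false (satisfies? st h) λ sat-h →
      notForced j pj (inj-h (trans (sat-h j pj) (trans (sym πc≡y′j) (trans (sym (swapAt-at₁ π x c)) (sym (fixed (here refl))))))))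
    where
    pj = proj₁ (target-elim {st} {π c} {j} t)
    πc≡y′j = proj₂ (target-elim {st} {π c} {j} t)

  -- If x is neither a pending x′ₖ nor attached, the choice must avoid the unused preimages of
  -- the pending targets.
  untouched : ∀ {x xs π U st} → Bound xs → Invariant π U (x ∷ xs) st → Fits U (x ∷ xs) st →
    (∀ k → Pending (st k) → x′ k ≢ x) → ¬ Attached st x →
    sumRuns π U (x ∷ xs) (sat st) ≤ runBound U (x ∷ xs) st
  untouched {x} {xs} {π} {U} {st} IH I fits notForced unattached = begin
    sumRuns π U (x ∷ xs) (sat st)                           ≤⟨ sum-mono-≤ (λ c → whenUnused-mono {U = U} {c = c} (choice c)) ⟩
    ∑[ c < n ] whenUnused U c (𝟙 (nonTarget c) * K)        ≡⟨ sum-cong-≗ (λ c → whenUnused-*ʳ {U = U} {c = c} (𝟙 (nonTarget c)) K) ⟨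
    ∑[ c < n ] (whenUnused U c (𝟙 (nonTarget c)) * K)      ≡⟨ *-distribʳ-sum K (λ c → whenUnused U c (𝟙 (nonTarget c))) ⟨
    nonTargets * K                                          ≤⟨ *-monoˡ-≤ K nonTargets≤ ⟩
    suc (M′ ∸ q₀) * K                                       ≡⟨ P′-suc (M′ ∸ q₀) (r ∸ s) ⟨
    suc (M′ ∸ q₀) P′ suc (r ∸ s)                            ≡⟨ cong₂ _P′_ M∸q₀≡1+[M′∸q₀] S≡1+[r∸s] ⟨
    runBound U (x ∷ xs) st                                  ∎
    where
    open ≤-Reasoning
    x∉U = Fresh-head (Invariant.fresh I)
    M′ = unusedCount (x ∷ U)
    q₀ = pendingCount st
    r  = length xs
    s  = attachedCount st xs
    K  = (M′ ∸ q₀) P′ (r ∸ s)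

    nonTarget : Fin n → Bool
    nonTarget c = not (does (target? st (π c)))

    nonTargets = ∑[ c < n ] whenUnused U c (𝟙 (nonTarget c))

    S≡1+[r∸s] : suc r ∸ attachedCount st (x ∷ xs) ≡ suc (r ∸ s)
    S≡1+[r∸s] = trans (cong (λ b → suc r ∸ (𝟙 b + s)) (dec-false (attached? st x) unattached)) (+-∸-assoc 1 (sumᴸ-𝟙≤length _ xs))

    fitsIH : q₀ + (r ∸ s) ≤ M′
    fitsIH = ≤-pred (subst₂ _≤_ (trans (cong (q₀ +_) S≡1+[r∸s]) (+-suc q₀ (r ∸ s))) (unusedCount-∷ x∉U) fits)

    M∸q₀≡1+[M′∸q₀] : unusedCount U ∸ q₀ ≡ suc (M′ ∸ q₀)
    M∸q₀≡1+[M′∸q₀] = trans (cong (_∸ q₀) (unusedCount-∷ x∉U)) (+-∸-assoc 1 (m+n≤o⇒m≤o q₀ fitsIH))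

    nonTargets≤ : nonTargets ≤ suc (M′ ∸ q₀)
    nonTargets≤ = subst (nonTargets ≤_) M∸q₀≡1+[M′∸q₀] (m+n≤o⇒m≤o∸n nonTargets (unusedNonTargets+pendingCount≤unusedCount I))

    choice : ∀ c → c ∉ U → sumRuns (swapAt π x c) (x ∷ U) xs (sat st) ≤ 𝟙 (nonTarget c) * K
    choice c c∉U with target? st (π c)
    ... | yes target    = ≤-trans (≤-reflexive (sumRuns-target-vanish (Invariant.injective I) (Fresh-tail (Invariant.fresh I)) notForced target)) z≤n
    ... | no  nonTarget = ≤-trans (IH (Invariant-swapAt-nonTarget I unattached c∉U nonTarget) fitsIH) (≤-reflexive (sym (*-identityˡ K)))

  forced? : ∀ (st : States) (x : Fin n) → Dec (∃ λ k → Pending (st k) × x′ k ≡ x)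
  forced? st x = any? λ k → T? (isPending (st k)) ×-dec (x′ k ≟ x)

  bound : ∀ xs → Bound xs
  bound []       _ _ = 𝟙≤1 _
  bound (x ∷ xs) {st = st} I fits with forced? st x
  ... | yes (k , pk , x′k≡x) = forced (bound xs) I fits pk x′k≡x
  ... | no  notForced        = byAttachment (attached? st x)
    where
    notForced′ : ∀ k → Pending (st k) → x′ k ≢ x
    notForced′ k pk x′k≡x = notForced (k , pk , x′k≡x)

    byAttachment : Dec (Attached st x) → _
    byAttachment (yes (l , stl)) = attachedStep (bound xs) I fits notForced′ stl
    byAttachment (no unattached) = untouched (bound xs) I fits notForced′ unattached

-- The initial state and the theorem

favourable≡sumRuns : ∀ {n r q} (f : Fin n → Fin n) (xs : Vec (Fin n) r) (xq yq : Vec (Fin n) q) →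
  favourable f xs xq yq ≡ sumRuns f [] (toList xs) (λ g → 𝟙 (allMatch g xq yq))
favourable≡sumRuns {n} {r} f xs xq yq = begin
  length (filterᵇ matches Ω)                                    ≡⟨ length≡sumᴸ-1 (filterᵇ matches Ω) ⟩
  sumᴸ (λ _ → 1) (filterᵇ matches Ω)                            ≡⟨ sumᴸ-filterᵇ (λ _ → 1) matches Ω ⟩
  sumᴸ (𝟙 ∘ matches) Ω                                          ≡⟨ sumᴸ-filterᵇ _ (admissible xs) (allVecs n r) ⟩
  sumᴸ (λ cs → if admissible xs cs then 𝟙 (matches cs) else 0) (allVecs n r)
                                                                ≡⟨ sumᴸ-allVecs≡sumRuns f [] xs (λ g → 𝟙 (allMatch g xq yq)) ⟩
  sumRuns f [] (toList xs) (λ g → 𝟙 (allMatch g xq yq))         ∎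
  where
  open ≡-Reasoning
  Ω = filterᵇ (admissible xs) (allVecs n r)
  matches : Vec (Fin n) r → Bool
  matches cs = allMatch (runSwap f xs cs) xq yq

length-sampleSpace≡sumRuns : ∀ {n r} (f : Fin n → Fin n) (xs : Vec (Fin n) r) →
  length (sampleSpace xs) ≡ sumRuns f [] (toList xs) (λ _ → 1)
length-sampleSpace≡sumRuns {n} {r} f xs = begin
  length (filterᵇ (admissible xs) (allVecs n r))                       ≡⟨ length≡sumᴸ-1 (filterᵇ (admissible xs) (allVecs n r)) ⟩
  sumᴸ (λ _ → 1) (filterᵇ (admissible xs) (allVecs n r))               ≡⟨ sumᴸ-filterᵇ _ (admissible xs) (allVecs n r) ⟩
  sumᴸ (λ cs → if admissible xs cs then 1 else 0) (allVecs n r)        ≡⟨ sumᴸ-allVecs≡sumRuns f [] xs (λ _ → 1) ⟩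
  sumRuns f [] (toList xs) (λ _ → 1)                                   ∎
  where open ≡-Reasoning

allMatch⇒lookup : ∀ {n q} (σ : Fin n → Fin n) (as bs : Vec (Fin n) q) → T (allMatch σ as bs) → ∀ j → σ (lookup as j) ≡ lookup bs j
allMatch⇒lookup σ (a ∷ as) (b ∷ bs) m j with Equivalence.to (T-∧ {σ a == b} {allMatch σ as bs}) m
allMatch⇒lookup σ (a ∷ as) (b ∷ bs) m zero    | σa≡b , _ = does-T (σ a ≟ b) σa≡b
allMatch⇒lookup σ (a ∷ as) (b ∷ bs) m (suc j) | _ , rest = allMatch⇒lookup σ as bs rest j

permutation-injective : ∀ {n} (π : Permutation′ n) → Injective _≡_ _≡_ (π ⟨$⟩ʳ_)
permutation-injective π = Injection.injective (↔⇒↣ π)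

P′≤length-sampleSpace : ∀ {n r} (xs : Vec (Fin n) r) → (∀ i j → lookup xs i ≡ lookup xs j → i ≡ j) →
  n P′ r ≤ length (sampleSpace xs)
P′≤length-sampleSpace {n} {r} xs xs-injective = begin
  n P′ r                                       ≡⟨ cong₂ _P′_ (unusedCount-[] {n}) (length-toList xs) ⟨
  unusedCount {n} [] P′ length (toList xs)     ≤⟨ P′≤sumRuns-1 id (Fresh-toList xs xs-injective λ _ ()) ⟩
  sumRuns id [] (toList xs) (λ _ → 1)          ≡⟨ length-sampleSpace≡sumRuns id xs ⟨
  length (sampleSpace xs)                      ∎
  where open ≤-Reasoning

initialStatus : ∀ {n r s q} → s ≤ r → Vec (Fin n) r → Fin q → Status n
initialStatus {s = s} s≤r xs j with toℕ j <? s
... | yes j<s = at (lookup xs (fromℕ< (<-≤-trans j<s s≤r)))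
... | no  _   = free

module Initial {n r q s : ℕ} (π : Permutation′ n) (xs : Vec (Fin n) r) (xq yq : Vec (Fin n) q)
  (xs-injective : ∀ i j → lookup xs i ≡ lookup xs j → i ≡ j)
  (xq-injective : ∀ i j → lookup xq i ≡ lookup xq j → i ≡ j)
  (yq-injective : ∀ i j → lookup yq i ≡ lookup yq j → i ≡ j)
  (s≤q : s ≤ q) (s≤r : s ≤ r)
  (linked : ∀ (i : Fin r) (j : Fin q) → toℕ i ≡ toℕ j → toℕ i < s →
    lookup xs i ≡ lookup xq j ⊎ π ⟨$⟩ʳ lookup xs i ≡ lookup yq j) where

  open Targets (lookup xq) (lookup yq) (xq-injective _ _) (yq-injective _ _)

  st₀ : States
  st₀ = initialStatus s≤r xs

  pendingCount-st₀ : pendingCount st₀ ≡ q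
  pendingCount-st₀ = trans (sum-cong-≗ λ j → 𝟙-T (pending j)) (sum-const-1 q)
    where
    pending : ∀ j → Pending (st₀ j)
    pending j with toℕ j <? s
    ... | yes _ = _
    ... | no  _ = _

  Invariant-st₀ : Invariant (π ⟨$⟩ʳ_) [] (toList xs) st₀
  Invariant-st₀ = record
    { injective = permutation-injective π
    ; fresh     = Fresh-toList xs xs-injective λ _ ()
    ; preimage  = λ j _ → π ⟨$⟩ˡ lookup yq j , (λ ()) , inverseʳ π
    ; attached  = attached₀
    }
    where
    attached₀ : ∀ {j y} → st₀ j ≡ at y → y ≡ lookup xq j ⊎ π ⟨$⟩ʳ y ≡ lookup yq j
    attached₀ {j} eq with toℕ j <? s
    attached₀ {j} refl | yes j<s = linked _ j (toℕ-fromℕ< (<-≤-trans j<s s≤r)) (subst (_< s) (sym (toℕ-fromℕ< _)) j<s)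

  s≤attachedCount-st₀ : s ≤ attachedCount st₀ (toList xs)
  s≤attachedCount-st₀ = subst (s ≤_) (sym (sumᴸ-toList _ xs)) (sum-≥-prefix _ s≤r λ i i<s →
    ≤-reflexive (sym (cong 𝟙 (dec-true (attached? st₀ (lookup xs i)) (attachedAt i i<s)))))
    where
    attachedAt : ∀ i → toℕ i < s → Attached st₀ (lookup xs i)
    attachedAt i i<s = j , byIndex
      where
      i<q = <-≤-trans i<s s≤q
      j : Fin q
      j = fromℕ< i<q
      byIndex : st₀ j ≡ at (lookup xs i)
      byIndex with toℕ j <? s
      ... | yes j<s = cong (at ∘ lookup xs) (toℕ-injective (trans (toℕ-fromℕ< _) (toℕ-fromℕ< i<q)))
      ... | no  j≮s = ⊥-elim (j≮s (subst (_< s) (sym (toℕ-fromℕ< i<q)) i<s))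

  favourable≤ : q + (r ∸ s) ≤ n → favourable (π ⟨$⟩ʳ_) xs xq yq ≤ (n ∸ q) P′ (r ∸ s)
  favourable≤ fits = begin
    favourable (π ⟨$⟩ʳ_) xs xq yq                        ≡⟨ favourable≡sumRuns (π ⟨$⟩ʳ_) xs xq yq ⟩
    sumRuns (π ⟨$⟩ʳ_) [] L (λ g → 𝟙 (allMatch g xq yq))  ≤⟨ sumRuns-mono (Invariant.fresh Invariant-st₀) (permutation-injective π) matches⇒sat ⟩
    sumRuns (π ⟨$⟩ʳ_) [] L (sat st₀)                     ≤⟨ bound L Invariant-st₀ fits₀ ⟩
    runBound [] L st₀                                    ≡⟨ cong₂ (λ M k → (M ∸ k) P′ (length L ∸ S₀)) (unusedCount-[] {n}) pendingCount-st₀ ⟩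
    (n ∸ q) P′ (length L ∸ S₀)                           ≡⟨ cong (λ l → (n ∸ q) P′ (l ∸ S₀)) (length-toList xs) ⟩
    (n ∸ q) P′ (r ∸ S₀)                                  ≤⟨ P′-mono (∸-monoʳ-≤ r s≤attachedCount-st₀)
                                                              (≤-trans (≤-reflexive (sym (m+n∸m≡n q (r ∸ s)))) (∸-monoˡ-≤ q fits)) ⟩
    (n ∸ q) P′ (r ∸ s)                                   ∎
    where
    open ≤-Reasoning
    L = toList xs
    S₀ = attachedCount st₀ L

    fits₀ : Fits [] L st₀
    fits₀ = subst₂ (λ k M → k + (length L ∸ S₀) ≤ M) (sym pendingCount-st₀) (sym (unusedCount-[] {n}))
      (≤-trans (+-monoʳ-≤ q (≤-trans (≤-reflexive (cong (_∸ S₀) (length-toList xs))) (∸-monoʳ-≤ r s≤attachedCount-st₀))) fits)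

    matches⇒sat : ∀ h → Injective _≡_ _≡_ h → (∀ {y} → y ∈ [] → h y ≡ π ⟨$⟩ʳ y) → 𝟙 (allMatch h xq yq) ≤ sat st₀ h
    matches⇒sat h _ _ = 𝟙-mono λ m → T-does (satisfies? st₀ h) λ j _ → allMatch⇒lookup h xq yq m j

proposition5p1 : (n r s q : ℕ) → s ≤ q → s ≤ r → q + (r ∸ s) ≤ n →
    (π : Permutation′ n) →
    (xs : Vec (Fin n) r) → (∀ i j → lookup xs i ≡ lookup xs j → i ≡ j) →
    (xq yq : Vec (Fin n) q) →
    (∀ i j → lookup xq i ≡ lookup xq j → i ≡ j) →
    (∀ i j → lookup yq i ≡ lookup yq j → i ≡ j) →
    (∀ (i : Fin r) (j : Fin q) → toℕ i ≡ toℕ j → toℕ i < s →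
      lookup xs i ≡ lookup xq j ⊎ π ⟨$⟩ʳ lookup xs i ≡ lookup yq j) →
    favourable (π ⟨$⟩ʳ_) xs xq yq * (n ! * (n ∸ (q + (r ∸ s))) !)
      ≤ length (sampleSpace xs) * ((n ∸ r) ! * (n ∸ q) !)
proposition5p1 n r s q s≤q s≤r fits π xs xs-injective xq yq xq-injective yq-injective linked = begin
  favourable (π ⟨$⟩ʳ_) xs xq yq * (n ! * (n ∸ (q + (r ∸ s))) !)
    ≤⟨ *-monoˡ-≤ _ (Initial.favourable≤ π xs xq yq xs-injective xq-injective yq-injective s≤q s≤r linked fits) ⟩
  ((n ∸ q) P′ (r ∸ s)) * (n ! * (n ∸ (q + (r ∸ s))) !)
    ≡⟨ P′-cross {n} {q} (m+n≤o⇒m≤o∸n (r ∸ s) (subst (_≤ n) (+-comm q (r ∸ s)) fits)) r≤n ⟩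
  (n P′ r) * ((n ∸ r) ! * (n ∸ q) !)
    ≤⟨ *-monoˡ-≤ _ (P′≤length-sampleSpace xs xs-injective) ⟩
  length (sampleSpace xs) * ((n ∸ r) ! * (n ∸ q) !)
    ∎
  where
  open ≤-Reasoning
  r≤n : r ≤ n
  r≤n = ≤-trans (≤-trans (≤-reflexive (sym (m+[n∸m]≡n s≤r))) (+-monoˡ-≤ (r ∸ s) s≤q)) fits
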